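{- Let $M , N_1, \dots, N_n \in \Lambda$ and $I$ be an interpretation. If $x_1 : \vec{a}_1, \dots, x_n : \vec{a}_n \vdash M : a$ is derivable in $E^S_A$ and $N_i \in [\![ \vec{a}_i ]\!]_{I}$ for each $i$, then $M[N_1,\dots,N_n/x_1,\dots,x_n] \in [\![ a ]\!]_{I}$.
   Context: Fix a resource monad $S$ with symmetric tensor product and a small category $A$; $D_A$ is the colimit of $D_0=A$, $D_{n+1}=(SD_n)^{o}\times D_n\sqcup A$, whose objects are types $o\in A$ or $\vec{a}\Rightarrow a$ ($\vec{a}\in SD_A$, lists of types). The type system $E^S_A$ has rules: variable $x_1:\vec{a}_1,\dots,x_n:\vec{a}_n\vdash x_i:a$ given morphisms $f_j:\vec{a}_j\to\langle\rangle$ ($j\neq i$) and $f:\vec{a}_i\to\langle a\rangle$ in $SD_A$; abstraction from $\Delta,x:\vec{a}\vdash M:a$ infer $\Delta\vdash\lambda x.M:\vec{a}\Rightarrow a$; application from $\Gamma_0\vdash M:\langle a_1,\dots,a_k\rangle\Rightarrow a$, $\Gamma_i\vdash N:a_i$ and $\eta:\Delta\to\bigotimes_{i=0}^k\Gamma_i$ infer $\Delta\vdash MN:a$. A set $\mathcal{X}\subseteq\Lambda$ is saturated if $M[N/x]N_1\dots N_n\in\mathcal{X}$ implies $(\lambda x.M)NN_1\dots N_n\in\mathcal{X}$; $\mathcal{X}_1\Rightarrow\mathcal{X}_2=\{M\mid\forall N\in\mathcal{X}_1,\ MN\in\mathcal{X}_2\}$. An interpretation is a functor $I:A\to((\wp\Lambda)^{\ast},\subseteq)$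 into saturated sets, and realizers are $[\![ o ]\!]_I=I(o)$, $[\![ \langle\rangle ]\!]_I=\Lambda$, $[\![ \langle a_1,\dots,a_k\rangle ]\!]_I=\bigcap_i[\![ a_i ]\!]_I$, $[\![ \vec{a}\Rightarrow a ]\!]_I=[\![ \vec{a} ]\!]_I\Rightarrow[\![ a ]\!]_I$. -}

module Defs where

open import Level using (0ℓ)
open import Data.Nat using (ℕ; zero; suc; _+_)
open import Data.Fin using (Fin; zero; suc; splitAt; _↑ˡ_; _↑ʳ_)
open import Data.Sum using (inj₁; inj₂; [_,_])
open import Data.List using (List; []; _∷_; length; lookup; _++_)
open import Data.Vec using (Vec; []; _∷_; replicate; zipWith)
import Data.Vec as V
open import Function using (_∘_; id)
open import Relation.Binary.PropositionalEquality using (_≡_; _≢_)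
open import Relation.Unary using (Pred; U; _∩_; _⊆_)

record Category : Set₁ where
  field
    Obj   : Set
    Hom   : Obj → Obj → Set
    idᶜ   : ∀ {a} → Hom a a
    _∘ᶜ_  : ∀ {a b c} → Hom b c → Hom a b → Hom a c
    idˡ   : ∀ {a b} (f : Hom a b) → idᶜ ∘ᶜ f ≡ f
    idʳ   : ∀ {a b} (f : Hom a b) → f ∘ᶜ idᶜ ≡ f
    assoc : ∀ {a b c d} (h : Hom c d) (g : Hom b c) (f : Hom a b) →
            (h ∘ᶜ g) ∘ᶜ f ≡ h ∘ᶜ (g ∘ᶜ f)

-- S C has as objects finite sequences (lists) of objects of C; a morphism
-- ⟨a_1..a_m⟩ → ⟨b_1..b_n⟩ is an admissible reindexing φ : [n] → [m]
-- together with morphisms a_{φ j} → b_j in C.  The resource monad is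
-- determined by which reindexings are admissible (bijections: Sym;
-- arbitrary functions: free cartesian completion; ...).

_⊕_ : ∀ {m n m' n'} → (Fin n → Fin m) → (Fin n' → Fin m') →
      Fin (n + n') → Fin (m + m')
_⊕_ {m} {n} {m'} φ ψ j = [ (λ x → φ x ↑ˡ m') , (λ y → m ↑ʳ ψ y) ] (splitAt n j)

-- reindexing of the braiding  a⃗ ⊗ b⃗ → b⃗ ⊗ a⃗  (|a⃗| = m, |b⃗| = n)
braid : ∀ m n → Fin (n + m) → Fin (m + n)
braid m n j = [ (λ x → m ↑ʳ x) , (λ y → y ↑ˡ n) ] (splitAt n j)

record ResourceMonad : Set₁ where
  field
    Adm     : ∀ {m n} → (Fin n → Fin m) → Set
    adm-id  : ∀ {n} → Adm {n} {n} id
    adm-∘   : ∀ {l m n} {φ : Fin m → Fin l} {ψ : Fin n → Fin m} →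
              Adm φ → Adm ψ → Adm (φ ∘ ψ)
    adm-⊗   : ∀ {m n m' n'} {φ : Fin n → Fin m} {ψ : Fin n' → Fin m'} →
              Adm φ → Adm ψ → Adm (φ ⊕ ψ)
    adm-σ   : ∀ m n → Adm (braid m n)

infixl 7 _·_
data Λ : Set where
  var : ℕ → Λ
  lam : Λ → Λ
  _·_ : Λ → Λ → Λ

ext : (ℕ → ℕ) → ℕ → ℕ
ext ρ zero    = zero
ext ρ (suc i) = suc (ρ i)

rename : (ℕ → ℕ) → Λ → Λ
rename ρ (var i) = var (ρ i)
rename ρ (lam M) = lam (rename (ext ρ) M)
rename ρ (M · N) = rename ρ M · rename ρ N

exts : (ℕ → Λ) → ℕ → Λ
exts σ zero    = var zero
exts σ (suc i) = rename suc (σ i)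

sub : (ℕ → Λ) → Λ → Λ
sub σ (var i) = σ i
sub σ (lam M) = lam (sub (exts σ) M)
sub σ (M · N) = sub σ M · sub σ N

_∷σ_ : Λ → (ℕ → Λ) → ℕ → Λ
(N ∷σ σ) zero    = N
(N ∷σ σ) (suc i) = σ i

_[_/0] : Λ → Λ → Λ
M [ N /0] = sub (N ∷σ var) M

_++σ_ : ∀ {n} → Vec Λ n → (ℕ → Λ) → ℕ → Λ
[] ++σ σ       = σ
(N ∷ Ns) ++σ σ = N ∷σ (Ns ++σ σ)

_[_]ˢ : ∀ {n} → Λ → Vec Λ n → Λ
M [ Ns ]ˢ = sub (Ns ++σ var) M

apps : Λ → List Λ → Λ
apps M []       = M
apps M (N ∷ Ns) = apps (M · N) Ns

Saturated : Pred Λ 0ℓ → Set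
Saturated X = ∀ M N (Ns : List Λ) → X (apps (M [ N /0]) Ns) → X (apps (lam M · N) Ns)

_⇛_ : Pred Λ 0ℓ → Pred Λ 0ℓ → Pred Λ 0ℓ
(X ⇛ Y) M = ∀ N → X N → Y (M · N)

module System (𝒜 : Category) (R : ResourceMonad) where
  open Category 𝒜
  open ResourceMonad R

  infixr 5 _⇒_
  data Ty : Set where
    base : Obj → Ty
    _⇒_  : List Ty → Ty → Ty

  data _⟶_ : Ty → Ty → Set
  data _⟶ˢ_ (as bs : List Ty) : Set

  data _⟶_ where
    base : ∀ {o o'} → Hom o o' → base o ⟶ base o'
    arr  : ∀ {as bs a b} → bs ⟶ˢ as → a ⟶ b → (as ⇒ a) ⟶ (bs ⇒ b)

  data _⟶ˢ_ as bs where
    smor : (φ : Fin (length bs) → Fin (length as)) → Adm φ →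
           ((j : Fin (length bs)) → lookup as (φ j) ⟶ lookup bs j) →
           as ⟶ˢ bs

  -- contexts x_1 : a⃗_1, ..., x_n : a⃗_n ; head of the vector = de Bruijn
  -- index 0 = the last declared variable x_n
  Ctx : ℕ → Set
  Ctx n = Vec (List Ty) n

  _⟶ᶜ_ : ∀ {n} → Ctx n → Ctx n → Set
  Δ ⟶ᶜ Γ = ∀ v → V.lookup Δ v ⟶ˢ V.lookup Γ v

  -- tensor of contexts (pointwise tensor = concatenation in S D_A)
  _⊗ᶜ_ : ∀ {n} → Ctx n → Ctx n → Ctx n
  Γ ⊗ᶜ Γ' = zipWith _++_ Γ Γ'

  ⨂ : ∀ {n k} → (Fin k → Ctx n) → Ctx n
  ⨂ {n} {zero}  Γs = replicate n []
  ⨂ {n} {suc k} Γs = Γs zero ⊗ᶜ ⨂ (Γs ∘ suc)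

  infix 3 _⊢_∶_
  data _⊢_∶_ : ∀ {n} → Ctx n → Λ → Ty → Set where
    ax  : ∀ {n} {Γ : Ctx n} {a} (i : Fin n) →
          V.lookup Γ i ⟶ˢ (a ∷ []) →
          (∀ j → j ≢ i → V.lookup Γ j ⟶ˢ []) →
          Γ ⊢ var (Data.Fin.toℕ i) ∶ a
    abs : ∀ {n} {Γ : Ctx n} {as a M} →
          (as ∷ Γ) ⊢ M ∶ a → Γ ⊢ lam M ∶ (as ⇒ a)
    app : ∀ {n} {Δ : Ctx n} {as : List Ty} {a M N}
          (Γ₀ : Ctx n) (Γs : Fin (length as) → Ctx n) →
          Γ₀ ⊢ M ∶ (as ⇒ a) →
          (∀ i → Γs i ⊢ N ∶ lookup as i) →
          Δ ⟶ᶜ (Γ₀ ⊗ᶜ ⨂ Γs) →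
          Δ ⊢ M · N ∶ a

  -- interpretations: functors A → (saturated sets, ⊆)
  record Interpretation : Set₁ where
    field
      I    : Obj → Pred Λ 0ℓ
      sat  : ∀ o → Saturated (I o)
      mono : ∀ {o o'} → Hom o o' → I o ⊆ I o'

  open Interpretation

  ⟦_⟧ : Ty → Interpretation → Pred Λ 0ℓ
  ⟦_⟧ˢ : List Ty → Interpretation → Pred Λ 0ℓ
  ⟦ base o ⟧ 𝐼 = I 𝐼 o
  ⟦ as ⇒ a ⟧ 𝐼 = ⟦ as ⟧ˢ 𝐼 ⇛ ⟦ a ⟧ 𝐼
  ⟦ [] ⟧ˢ 𝐼     = U
  ⟦ a ∷ as ⟧ˢ 𝐼 = ⟦ a ⟧ 𝐼 ∩ ⟦ as ⟧ˢ 𝐼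

module Submission where

-- The theorem is proved in the stronger form "adequacy": if Γ ⊢ M ∶ a and
-- σ is ANY substitution whose value at each variable x_i realizes the
-- type list a⃗_i of Γ, then sub σ M realizes a.  This generalisation is
-- needed because the abstraction case extends σ by a fresh term.  The
-- proof is by induction on the derivation and rests on four facts:
--   (1) substitution algebra: substituting after extending a substitution
--       under a binder is a single substitution (β-substitution lemma);
--   (2) every realizer ⟦ a ⟧ is saturated, since saturated sets are closed
--       under X ⇛ _ (this handles abstraction, via weak head expansion);
--   (3) morphisms of D_A and of S D_A induce inclusions of realizers
--       (this handles the morphisms in the axiom and application rules);
--   (4) a realizer of a tensor of contexts realizes each factor.

open import Defs
open import Data.Nat using (ℕ; zero; suc)
open import Data.Vec using (Vec; lookup; []; _∷_)
open import Data.Vec.Properties using (lookup-zipWith)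
open import Data.Fin using (Fin; toℕ) renaming (zero to fzero; suc to fsuc)
import Data.List as L
open import Data.List using (List; _++_)
open import Data.Product using (_×_; _,_; proj₁; proj₂)
open import Relation.Binary.PropositionalEquality
  using (_≡_; refl; sym; trans; cong; cong₂; subst)
open import Relation.Unary using (Pred)
open import Level using (0ℓ)
open import Function using (_∘_)

rename-cong : ∀ {ρ ρ'} → (∀ i → ρ i ≡ ρ' i) → ∀ M → rename ρ M ≡ rename ρ' M
rename-cong e (var i) = cong var (e i)
rename-cong {ρ} {ρ'} e (lam M) = cong lam (rename-cong ext-cong M)
  where
  ext-cong : ∀ i → ext ρ i ≡ ext ρ' i
  ext-cong zero    = refl
  ext-cong (suc i) = cong suc (e i)
rename-cong e (M · N) = cong₂ _·_ (rename-cong e M) (rename-cong e N)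

sub-cong : ∀ {σ τ} → (∀ i → σ i ≡ τ i) → ∀ M → sub σ M ≡ sub τ M
sub-cong e (var i) = e i
sub-cong {σ} {τ} e (lam M) = cong lam (sub-cong exts-cong M)
  where
  exts-cong : ∀ i → exts σ i ≡ exts τ i
  exts-cong zero    = refl
  exts-cong (suc i) = cong (rename suc) (e i)
sub-cong e (M · N) = cong₂ _·_ (sub-cong e M) (sub-cong e N)

rename-rename : ∀ ρ ρ' M → rename ρ (rename ρ' M) ≡ rename (ρ ∘ ρ') M
rename-rename ρ ρ' (var i) = refl
rename-rename ρ ρ' (lam M) =
  cong lam (trans (rename-rename (ext ρ) (ext ρ') M)
                  (rename-cong (λ { zero → refl ; (suc i) → refl }) M))
rename-rename ρ ρ' (M · N) = cong₂ _·_ (rename-rename ρ ρ' M) (rename-rename ρ ρ' N)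

sub-rename : ∀ τ ρ M → sub τ (rename ρ M) ≡ sub (τ ∘ ρ) M
sub-rename τ ρ (var i) = refl
sub-rename τ ρ (lam M) =
  cong lam (trans (sub-rename (exts τ) (ext ρ) M)
                  (sub-cong (λ { zero → refl ; (suc i) → refl }) M))
sub-rename τ ρ (M · N) = cong₂ _·_ (sub-rename τ ρ M) (sub-rename τ ρ N)

rename-sub : ∀ ρ σ M → rename ρ (sub σ M) ≡ sub (rename ρ ∘ σ) M
rename-sub ρ σ (var i) = refl
rename-sub ρ σ (lam M) =
  cong lam (trans (rename-sub (ext ρ) (exts σ) M) (sub-cong ext-exts M))
  where
  ext-exts : ∀ i → rename (ext ρ) (exts σ i) ≡ exts (rename ρ ∘ σ) i
  ext-exts zero    = refl
  ext-exts (suc i) = trans (rename-rename (ext ρ) suc (σ i))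
                           (sym (rename-rename suc ρ (σ i)))
rename-sub ρ σ (M · N) = cong₂ _·_ (rename-sub ρ σ M) (rename-sub ρ σ N)

sub-sub : ∀ τ σ M → sub τ (sub σ M) ≡ sub (sub τ ∘ σ) M
sub-sub τ σ (var i) = refl
sub-sub τ σ (lam M) =
  cong lam (trans (sub-sub (exts τ) (exts σ) M) (sub-cong exts-exts M))
  where
  exts-exts : ∀ i → sub (exts τ) (exts σ i) ≡ exts (sub τ ∘ σ) i
  exts-exts zero    = refl
  exts-exts (suc i) = trans (sub-rename (exts τ) suc (σ i))
                            (sym (rename-sub suc τ (σ i)))
sub-sub τ σ (M · N) = cong₂ _·_ (sub-sub τ σ M) (sub-sub τ σ N)

sub-id : ∀ M → sub var M ≡ M
sub-id (var i) = refl
sub-id (lam M) =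
  cong lam (trans (sub-cong (λ { zero → refl ; (suc i) → refl }) M) (sub-id M))
sub-id (M · N) = cong₂ _·_ (sub-id M) (sub-id N)

β-sub : ∀ σ N M → (sub (exts σ) M) [ N /0] ≡ sub (N ∷σ σ) M
β-sub σ N M = trans (sub-sub (N ∷σ var) (exts σ) M) (sub-cong exts-then-β M)
  where
  exts-then-β : ∀ i → sub (N ∷σ var) (exts σ i) ≡ (N ∷σ σ) i
  exts-then-β zero    = refl
  exts-then-β (suc i) = trans (sub-rename (N ∷σ var) suc (σ i)) (sub-id (σ i))

++σ-lookup : ∀ {n} (Ns : Vec Λ n) (i : Fin n) → (Ns ++σ var) (toℕ i) ≡ lookup Ns i
++σ-lookup (N ∷ Ns) fzero    = refl
++σ-lookup (N ∷ Ns) (fsuc i) = ++σ-lookup Ns i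

apps-snoc : ∀ M Ns P → apps M (Ns ++ P L.∷ L.[]) ≡ apps M Ns · P
apps-snoc M L.[]       P = refl
apps-snoc M (N L.∷ Ns) P = apps-snoc (M · N) Ns P

-- An extra argument P of a head redex is just one more trailing argument.
⇛-saturated : (X Y : Pred Λ 0ℓ) → Saturated Y → Saturated (X ⇛ Y)
⇛-saturated X Y satY M N Ns h P hP =
  subst Y (apps-snoc (lam M · N) Ns P)
    (satY M N (Ns ++ P L.∷ L.[])
      (subst Y (sym (apps-snoc (M [ N /0]) Ns P)) (h P hP)))

module Adequacy (𝒜 : Category) (S : ResourceMonad) where
  open System 𝒜 S
  open Interpretation

  module _ (𝐼 : Interpretation) where

    ⟦⟧-saturated : ∀ a → Saturated (⟦ a ⟧ 𝐼)
    ⟦⟧-saturated (base o) = sat 𝐼 o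
    ⟦⟧-saturated (as ⇒ a) = ⇛-saturated (⟦ as ⟧ˢ 𝐼) (⟦ a ⟧ 𝐼) (⟦⟧-saturated a)

    ⟦⟧ˢ-lookup : ∀ as {N} → ⟦ as ⟧ˢ 𝐼 N → ∀ j → ⟦ L.lookup as j ⟧ 𝐼 N
    ⟦⟧ˢ-lookup (a L.∷ as) (h , _) fzero    = h
    ⟦⟧ˢ-lookup (a L.∷ as) (_ , h) (fsuc j) = ⟦⟧ˢ-lookup as h j

    ⟦⟧ˢ-tabulate : ∀ as {N} → (∀ j → ⟦ L.lookup as j ⟧ 𝐼 N) → ⟦ as ⟧ˢ 𝐼 N
    ⟦⟧ˢ-tabulate L.[]       h = _
    ⟦⟧ˢ-tabulate (a L.∷ as) h = h fzero , ⟦⟧ˢ-tabulate as (h ∘ fsuc)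

    ⟦⟧-mono  : ∀ {a b} → a ⟶ b → ∀ {N} → ⟦ a ⟧ 𝐼 N → ⟦ b ⟧ 𝐼 N
    ⟦⟧ˢ-mono : ∀ {as bs} → as ⟶ˢ bs → ∀ {N} → ⟦ as ⟧ˢ 𝐼 N → ⟦ bs ⟧ˢ 𝐼 N
    ⟦⟧-mono (base f)  h       = mono 𝐼 f h
    ⟦⟧-mono (arr g f) h P hP  = ⟦⟧-mono f (h P (⟦⟧ˢ-mono g hP))
    ⟦⟧ˢ-mono {as} {bs} (smor φ _ fs) h =
      ⟦⟧ˢ-tabulate bs (λ j → ⟦⟧-mono (fs j) (⟦⟧ˢ-lookup as h (φ j)))

    ⟦⟧ˢ-++ : ∀ xs ys {N} → ⟦ xs ++ ys ⟧ˢ 𝐼 N → ⟦ xs ⟧ˢ 𝐼 N × ⟦ ys ⟧ˢ 𝐼 N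
    ⟦⟧ˢ-++ L.[]       ys h        = _ , h
    ⟦⟧ˢ-++ (x L.∷ xs) ys (h , hs) =
      let (hxs , hys) = ⟦⟧ˢ-++ xs ys hs in (h , hxs) , hys

    Realizes : ∀ {n} → Ctx n → (ℕ → Λ) → Set
    Realizes Γ σ = ∀ v → ⟦ lookup Γ v ⟧ˢ 𝐼 (σ (toℕ v))

    ⊗ᶜ-split : ∀ {n} (Γ Γ' : Ctx n) σ → Realizes (Γ ⊗ᶜ Γ') σ →
               Realizes Γ σ × Realizes Γ' σ
    ⊗ᶜ-split Γ Γ' σ h =
      (λ v → proj₁ (split v)) , (λ v → proj₂ (split v))
      where
      split : ∀ v → ⟦ lookup Γ v ⟧ˢ 𝐼 (σ (toℕ v)) × ⟦ lookup Γ' v ⟧ˢ 𝐼 (σ (toℕ v))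
      split v = ⟦⟧ˢ-++ (lookup Γ v) (lookup Γ' v)
                  (subst (λ X → ⟦ X ⟧ˢ 𝐼 _) (lookup-zipWith _++_ v Γ Γ') (h v))

    ⨂-proj : ∀ {n k} (Γs : Fin k → Ctx n) (i : Fin k) σ →
             Realizes (⨂ Γs) σ → Realizes (Γs i) σ
    ⨂-proj Γs fzero    σ h = proj₁ (⊗ᶜ-split (Γs fzero) (⨂ (Γs ∘ fsuc)) σ h)
    ⨂-proj Γs (fsuc i) σ h =
      ⨂-proj (Γs ∘ fsuc) i σ (proj₂ (⊗ᶜ-split (Γs fzero) (⨂ (Γs ∘ fsuc)) σ h))

    ⟶ᶜ-mono : ∀ {n} (Δ Γ : Ctx n) → Δ ⟶ᶜ Γ → ∀ σ → Realizes Δ σ → Realizes Γ σ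
    ⟶ᶜ-mono Δ Γ η σ h v = ⟦⟧ˢ-mono (η v) (h v)

    adequacy : ∀ {n} {Γ : Ctx n} {M a} → Γ ⊢ M ∶ a →
               ∀ σ → Realizes Γ σ → ⟦ a ⟧ 𝐼 (sub σ M)
    adequacy (ax i f _) σ h = proj₁ (⟦⟧ˢ-mono f (h i))
    adequacy {Γ = Γ} (abs {as = as} {a} {M} d) σ h N hN =
      ⟦⟧-saturated a (sub (exts σ) M) N L.[]
        (subst (⟦ a ⟧ 𝐼) (sym (β-sub σ N M)) (adequacy d (N ∷σ σ) h'))
      where
      h' : Realizes (as ∷ Γ) (N ∷σ σ)
      h' fzero    = hN
      h' (fsuc v) = h v
    adequacy {Γ = Δ} (app {as = as} {N = N} Γ₀ Γs dM dN η) σ h =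
      adequacy dM σ hΓ₀ (sub σ N)
        (⟦⟧ˢ-tabulate as (λ i → adequacy (dN i) σ (⨂-proj Γs i σ hΓs)))
      where
      hΓ₀⊗Γs : Realizes (Γ₀ ⊗ᶜ ⨂ Γs) σ
      hΓ₀⊗Γs = ⟶ᶜ-mono Δ (Γ₀ ⊗ᶜ ⨂ Γs) η σ h
      hΓ₀ : Realizes Γ₀ σ
      hΓ₀ = proj₁ (⊗ᶜ-split Γ₀ (⨂ Γs) σ hΓ₀⊗Γs)
      hΓs : Realizes (⨂ Γs) σ
      hΓs = proj₂ (⊗ᶜ-split Γ₀ (⨂ Γs) σ hΓ₀⊗Γs)

lemma5 : (𝒜 : Category) (S : ResourceMonad) →
    let open System 𝒜 S in
    (I : Interpretation) {n : ℕ} (Γ : Ctx n) (M : Λ) (a : Ty) (Ns : Vec Λ n) →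
    Γ ⊢ M ∶ a →
    (∀ i → ⟦ lookup Γ i ⟧ˢ I (lookup Ns i)) →
    ⟦ a ⟧ I (M [ Ns ]ˢ)
lemma5 𝒜 S I Γ M a Ns d hNs = adequacy I d (Ns ++σ var) realizes
  where
  open System 𝒜 S
  open Adequacy 𝒜 S using (Realizes; adequacy)
  realizes : Realizes I Γ (Ns ++σ var)
  realizes i = subst (⟦ lookup Γ i ⟧ˢ I) (sym (++σ-lookup Ns i)) (hNs i)
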